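{- For every MCCS term $P$, the MLLa formula $\lceil P\rceil$ (the synchronous translation of $P$) has a unique cut-free proof (as a proof net). This proof is denoted $\lceil P\rceil^{\pi}$.
   Context: MCCS terms are generated by $P,Q ::= 1 \mid P\parallel Q \mid a.P \mid \bar a.P$, where $a$ ranges over a set of channel names ($a.P$ is a positive action prefix, $\bar a.P$ a negative one). MLLa formulas are generated by $A,B ::= \alpha \mid \alpha^\perp \mid A\otimes B \mid A⅋B \mid \mathsf{M}^+_a A \mid \mathsf{M}^-_a A$, where $\alpha$ ranges over propositional variables and $a$ over channel names. Negation is defined inductively: $(\alpha)^\perp=\alpha^\perp$, $(\alpha^\perp)^\perp=\alpha$, $(A\otimes B)^\perp=A^\perp⅋B^\perp$, $(A⅋B)^\perp=A^\perp\otimes B^\perp$, $(\mathsf{M}^+_aA)^\perp=\mathsf{M}^-_a(A^\perp)$, $(\mathsf{M}^-_aA)^\perp=\mathsf{M}^+_a(A^\perp)$. Proofs are those of the one-sided sequent calculus with rules: axiom $\vdash A^\perp,A$; cut (from $\vdash\Gamma,A$ and $\vdash A^\perp,\Delta$ infer $\vdash\Gamma,\Delta$); $\otimes$ (from $\vdash\Gamma,A$ and $\vdash B,\Delta$ infer $\vdash\Gamma,A\otimes B,\Delta$); $⅋$ (from $\vdash\Gamma,A,B$ infer $\vdash\Gamma,A⅋B$); and modality rules (from $\vdash\Gamma,A$ infer $\vdash\Gamma,\mathsf{M}^+_aA$, and from $\vdash\Gamma,A$ infer $\vdash\Gamma,\mathsf{M}^-_aA$). Proofs are considered as proof nets, i.e.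 the graphs (with links ax, cut, $\otimes$, $⅋$, $\mathsf{M}^+_a$, $\mathsf{M}^-_a$) obtained by translating sequent calculus proofs, thus identifying proofs up to permutation of rules. Synchronous translation: each MCCS term $P$ is mapped to a formula $\lceil P\rceil$ by $\lceil 1\rceil = \alpha^\perp⅋\alpha$, $\lceil P\parallel Q\rceil = \lceil P\rceil\otimes\lceil Q\rceil$, $\lceil a.P\rceil = \mathsf{M}^+_a(\alpha^\perp⅋(\lceil P\rceil\otimes\alpha))$, $\lceil \bar a.P\rceil = \mathsf{M}^-_a(\lceil P\rceil\otimes\alpha^\perp)⅋\alpha$, where in each clause $\alpha$ is a fresh propositional variable (so each variable occurs exactly once positively and once negatively). -}

module Defs where

open import Data.Nat using (ℕ; suc)
open import Data.Product using (_×_; _,_; proj₁)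
open import Data.Sum using (_⊎_)
open import Data.List using (List; []; _∷_; _++_)
open import Data.List.Membership.Propositional using (_∈_)
open import Data.List.Relation.Binary.Permutation.Propositional using (_↭_)
open import Function.Bundles using (_⇔_)

module _ {Name : Set} where

  -- MCCS terms:  P ::= 1 | P ∥ Q | a.P | ā.P
  data Term : Set where
    one  : Term
    _∥_  : Term → Term → Term
    pos  : Name → Term → Term
    neg  : Name → Term → Term

  data Formula : Set where
    var  : ℕ → Formula
    nvar : ℕ → Formula
    _⊗_  : Formula → Formula → Formula
    _⅋_  : Formula → Formula → Formula
    M⁺   : Name → Formula → Formula
    M⁻   : Name → Formula → Formula

  _^⊥ : Formula → Formula
  var x ^⊥   = nvar x
  nvar x ^⊥  = var x
  (A ⊗ B) ^⊥ = (A ^⊥) ⅋ (B ^⊥)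
  (A ⅋ B) ^⊥ = (A ^⊥) ⊗ (B ^⊥)
  M⁺ a A ^⊥  = M⁻ a (A ^⊥)
  M⁻ a A ^⊥  = M⁺ a (A ^⊥)

  -- Synchronous translation.  The natural-number argument is the next
  -- unused variable, so every clause uses a fresh variable.
  translate : Term → ℕ → Formula × ℕ
  translate one n = (nvar n ⅋ var n) , suc n
  translate (P ∥ Q) n with translate P n
  ... | A , m with translate Q m
  ... | B , k = (A ⊗ B) , k
  translate (pos a P) n with translate P (suc n)
  ... | A , m = M⁺ a (nvar n ⅋ (A ⊗ var n)) , m
  translate (neg a P) n with translate P (suc n)
  ... | A , m = (M⁻ a (A ⊗ nvar n) ⅋ var n) , m

  ⌈_⌉ : Term → Formula
  ⌈ P ⌉ = proj₁ (translate P 0)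

  -- Occurrences of subformulas of the conclusion are identified by
  -- their address (path from the node up to the root of the conclusion).
  data Dir : Set where
    left right under : Dir

  Path : Set
  Path = List Dir

  Located : Set
  Located = Formula × Path

  data CutFree : List Located → Set where
    ax   : ∀ A p q → CutFree ((A ^⊥ , p) ∷ (A , q) ∷ [])
    ⊗-r  : ∀ {A B p Γ Δ} → CutFree ((A , left ∷ p) ∷ Γ) → CutFree ((B , right ∷ p) ∷ Δ)
         → CutFree ((A ⊗ B , p) ∷ Γ ++ Δ)
    ⅋-r  : ∀ {A B p Γ} → CutFree ((A , left ∷ p) ∷ (B , right ∷ p) ∷ Γ)
         → CutFree ((A ⅋ B , p) ∷ Γ)
    M⁺-r : ∀ {a A p Γ} → CutFree ((A , under ∷ p) ∷ Γ) → CutFree ((M⁺ a A , p) ∷ Γ)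
    M⁻-r : ∀ {a A p Γ} → CutFree ((A , under ∷ p) ∷ Γ) → CutFree ((M⁻ a A , p) ∷ Γ)
    ex   : ∀ {Γ Δ} → Γ ↭ Δ → CutFree Γ → CutFree Δ

  -- The proof net of a cut-free proof: the conclusion's formula tree is
  -- fixed, so the net is determined by its axiom links (pairs of addresses).
  axLinks : ∀ {Γ} → CutFree Γ → List (Path × Path)
  axLinks (ax A p q)   = (p , q) ∷ []
  axLinks (⊗-r π ρ)    = axLinks π ++ axLinks ρ
  axLinks (⅋-r π)      = axLinks π
  axLinks (M⁺-r π)     = axLinks π
  axLinks (M⁻-r π)     = axLinks π
  axLinks (ex _ π)     = axLinks π

  Linked : ∀ {Γ} → CutFree Γ → Path → Path → Set
  Linked π p q = ((p , q) ∈ axLinks π) ⊎ ((q , p) ∈ axLinks π)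

  SameNet : ∀ {Γ} → CutFree Γ → CutFree Γ → Set
  SameNet π ρ = ∀ p q → Linked π p q ⇔ Linked ρ p q

-- Every variable of ⌈P⌉ occurs exactly once positively and once negatively
-- (linearity), and every compound subformula of ⌈P⌉ contains both occurrences
-- of some variable (saturation).  In a saturated linear formula a compound
-- formula A and its dual A^⊥ never both occur: the two occurrences of a
-- variable would place A and A^⊥ at the same address.  Hence every axiom of a
-- cut-free proof links an atom to its dual, whose address is unique, and every
-- atom is an endpoint of some axiom, so the axiom links, and with them the
-- proof net, are forced.

module Submission where

open import Defs
open import Data.Product using (Σ; Σ-syntax; ∃; ∃₂; _×_; _,_; proj₁; proj₂; map₁; map₂)
open import Data.Sum as Sum using (inj₁; inj₂)
open import Data.List using (List; []; _∷_; _++_; length; reverse; _ʳ++_)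
open import Data.List.Properties
  using (∷-injectiveˡ; ∷-injectiveʳ; length-++; unfold-reverse; reverse-injective; reverse-involutive)
open import Data.List.Membership.Propositional using (_∈_)
open import Data.List.Membership.Propositional.Properties using (∈-++⁺ˡ; ∈-++⁺ʳ; ∈-++⁻)
open import Data.List.Relation.Unary.Any using (here; there)
open import Data.List.Relation.Unary.All using (All; []; _∷_)
open import Data.List.Relation.Unary.All.Properties using (++⁻ˡ; ++⁻ʳ)
open import Data.List.Relation.Binary.Permutation.Propositional using (↭-sym; ↭-refl; swap)
open import Data.List.Relation.Binary.Permutation.Propositional.Properties using (All-resp-↭; ∈-resp-↭)
open import Data.Nat using (ℕ; zero; suc; _+_; _≤_; _<_)
open import Data.Nat.Properties
  using (suc-injective; +-assoc; m≢1+n+m; ≤-refl; ≤-trans; n≤1+n; <-≤-trans; <⇒≤; <-irrefl)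
open import Data.Empty using (⊥; ⊥-elim)
open import Function.Bundles using (mk⇔)
open import Relation.Nullary using (¬_; Dec; yes; no)
open import Relation.Binary.PropositionalEquality using (_≡_; _≢_; refl; sym; trans; cong; cong₂; subst)

+-cross-cancel : ∀ a b {x y} → a + x ≡ b + y → a + y ≡ b + x → a ≡ b
+-cross-cancel zero    zero    _ _ = refl
+-cross-cancel (suc a) (suc b) e e′ = cong suc (+-cross-cancel a b (suc-injective e) (suc-injective e′))
+-cross-cancel zero    (suc b) {x} e e′ =
  ⊥-elim (m≢1+n+m x (trans e (trans (cong (suc b +_) e′) (cong suc (sym (+-assoc b (suc b) x))))))
+-cross-cancel (suc a) zero    e e′ = sym (+-cross-cancel zero (suc a) (sym e′) (sym e))

module _ {X : Set} where

  ++-prefix-unique : ∀ (r r′ : List X) {s s′} →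
                     length r ≡ length r′ → r ++ s ≡ r′ ++ s′ → r ≡ r′
  ++-prefix-unique []      []       _ _ = refl
  ++-prefix-unique (x ∷ r) (y ∷ r′) l e =
    cong₂ _∷_ (∷-injectiveˡ e) (++-prefix-unique r r′ (suc-injective l) (∷-injectiveʳ e))

  ++-cross-cancel : ∀ (r r′ : List X) {s s′} →
                    r ++ s ≡ r′ ++ s′ → r ++ s′ ≡ r′ ++ s → r ≡ r′
  ++-cross-cancel r r′ e e′ =
    ++-prefix-unique r r′ (+-cross-cancel (length r) (length r′) (lengths e) (lengths e′)) e
    where
    lengths : ∀ {t t′} → r ++ t ≡ r′ ++ t′ → length r + length t ≡ length r′ + length t′
    lengths e″ = trans (sym (length-++ r)) (trans (cong length e″) (length-++ r′))

module _ {Name : Set} where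

  private variable
    k n m : ℕ
    A B C : Formula {Name}
    p q r r′ s s′ : Path {Name}
    Γ Δ : List (Located {Name})

  data Atom (k : ℕ) : Formula {Name} → Set where
    var  : Atom k (var k)
    nvar : Atom k (nvar k)

  Atomic : Formula {Name} → Set
  Atomic A = ∃ λ k → Atom k A

  atomic? : (A : Formula {Name}) → Dec (Atomic A)
  atomic? (var k)  = yes (k , var)
  atomic? (nvar k) = yes (k , nvar)
  atomic? (_ ⊗ _)  = no λ ()
  atomic? (_ ⅋ _)  = no λ ()
  atomic? (M⁺ _ _) = no λ ()
  atomic? (M⁻ _ _) = no λ ()

  atom-^⊥ : Atom k A → Atom k (A ^⊥)
  atom-^⊥ var  = nvar
  atom-^⊥ nvar = var

  ^⊥-involutive : (A : Formula {Name}) → A ^⊥ ^⊥ ≡ A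
  ^⊥-involutive (var _)  = refl
  ^⊥-involutive (nvar _) = refl
  ^⊥-involutive (A ⊗ B)  = cong₂ _⊗_ (^⊥-involutive A) (^⊥-involutive B)
  ^⊥-involutive (A ⅋ B)  = cong₂ _⅋_ (^⊥-involutive A) (^⊥-involutive B)
  ^⊥-involutive (M⁺ a A) = cong (M⁺ a) (^⊥-involutive A)
  ^⊥-involutive (M⁻ a A) = cong (M⁻ a) (^⊥-involutive A)

  ^⊥-injective : A ^⊥ ≡ B ^⊥ → A ≡ B
  ^⊥-injective {A} {B} e = trans (sym (^⊥-involutive A)) (trans (cong _^⊥ e) (^⊥-involutive B))

  A≢A^⊥ : (A : Formula {Name}) → A ≢ A ^⊥
  A≢A^⊥ (var _)  ()
  A≢A^⊥ (nvar _) ()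
  A≢A^⊥ (_ ⊗ _)  ()
  A≢A^⊥ (_ ⅋ _)  ()
  A≢A^⊥ (M⁺ _ _) ()
  A≢A^⊥ (M⁻ _ _) ()

  -- Relative paths are read from the root downwards, addresses upwards: the
  -- subformula at s of a formula located at p is located at s ʳ++ p.
  data Sub : Formula {Name} → Path {Name} → Formula {Name} → Set where
    here : Sub A [] A
    ⊗ˡ   : Sub A s C → Sub (A ⊗ B) (left ∷ s) C
    ⊗ʳ   : Sub B s C → Sub (A ⊗ B) (right ∷ s) C
    ⅋ˡ   : Sub A s C → Sub (A ⅋ B) (left ∷ s) C
    ⅋ʳ   : Sub B s C → Sub (A ⅋ B) (right ∷ s) C
    M⁺↓  : ∀ {a} → Sub A s C → Sub (M⁺ a A) (under ∷ s) C
    M⁻↓  : ∀ {a} → Sub A s C → Sub (M⁻ a A) (under ∷ s) C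

  sub-trans : Sub A r B → Sub B s C → Sub A (r ++ s) C
  sub-trans here    e = e
  sub-trans (⊗ˡ d)  e = ⊗ˡ (sub-trans d e)
  sub-trans (⊗ʳ d)  e = ⊗ʳ (sub-trans d e)
  sub-trans (⅋ˡ d)  e = ⅋ˡ (sub-trans d e)
  sub-trans (⅋ʳ d)  e = ⅋ʳ (sub-trans d e)
  sub-trans (M⁺↓ d) e = M⁺↓ (sub-trans d e)
  sub-trans (M⁻↓ d) e = M⁻↓ (sub-trans d e)

  sub-functional : Sub A s B → Sub A s C → B ≡ C
  sub-functional here    here    = refl
  sub-functional (⊗ˡ d)  (⊗ˡ e)  = sub-functional d e
  sub-functional (⊗ʳ d)  (⊗ʳ e)  = sub-functional d e
  sub-functional (⅋ˡ d)  (⅋ˡ e)  = sub-functional d e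
  sub-functional (⅋ʳ d)  (⅋ʳ e)  = sub-functional d e
  sub-functional (M⁺↓ d) (M⁺↓ e) = sub-functional d e
  sub-functional (M⁻↓ d) (M⁻↓ e) = sub-functional d e

  sub-^⊥ : Sub A s B → Sub (A ^⊥) s (B ^⊥)
  sub-^⊥ here    = here
  sub-^⊥ (⊗ˡ d)  = ⅋ˡ (sub-^⊥ d)
  sub-^⊥ (⊗ʳ d)  = ⅋ʳ (sub-^⊥ d)
  sub-^⊥ (⅋ˡ d)  = ⊗ˡ (sub-^⊥ d)
  sub-^⊥ (⅋ʳ d)  = ⊗ʳ (sub-^⊥ d)
  sub-^⊥ (M⁺↓ d) = M⁻↓ (sub-^⊥ d)
  sub-^⊥ (M⁻↓ d) = M⁺↓ (sub-^⊥ d)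

  sub-atom : Atom k A → Sub A s B → s ≡ []
  sub-atom var  here = refl
  sub-atom nvar here = refl

  Linear : Formula {Name} → Set
  Linear A = ∀ {k B s s′} → Atom k B → Sub A s B → Sub A s′ B → s ≡ s′

  DualPair : Formula {Name} → Set
  DualPair A = ∃ λ k → ∃₂ λ s s′ → Sub A s (var k) × Sub A s′ (nvar k)

  Saturated : Formula {Name} → Set
  Saturated A = ∀ {s B} → Sub A s B → ¬ Atomic B → DualPair B

  dualPair-lift : Sub A s B → DualPair B → DualPair A
  dualPair-lift d (k , _ , _ , e , e′) = k , _ , _ , sub-trans d e , sub-trans d e′

  module _ {F : Formula {Name}} (linear : Linear F) (saturated : Saturated F) where

    -- A data type rather than a synonym, so that the address p can be inferred.
    data Occurs (A : Formula {Name}) (p : Path {Name}) : Set where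
      occurs : Sub F (reverse p) A → Occurs A p

    dual-occurrences⇒atomic : Occurs (A ^⊥) p → Occurs A q → Atomic A
    dual-occurrences⇒atomic {A} {p} {q} (occurs d) (occurs d′) with atomic? A
    ... | yes atomic = atomic
    ... | no compound with saturated d′ compound
    ...   | _ , _ , _ , x , x̄ =
      ⊥-elim (A≢A^⊥ A (sub-functional d′ (subst (λ t → Sub F t (A ^⊥)) (sym same-address) d)))
      where
      same-address : reverse q ≡ reverse p
      same-address = ++-cross-cancel (reverse q) (reverse p)
        (linear var  (sub-trans d′ x) (sub-trans d (sub-^⊥ x̄)))
        (linear nvar (sub-trans d′ x̄) (sub-trans d (sub-^⊥ x)))

    AllOccur : List (Located {Name}) → Set
    AllOccur = All (λ L → Occurs (proj₁ L) (proj₂ L))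

    descend : ∀ {x} → Occurs A p → Sub A (x ∷ []) B → Occurs B (x ∷ p)
    descend {p = p} {x = x} (occurs d) e =
      occurs (subst (λ t → Sub F t _) (sym (unfold-reverse x p)) (sub-trans d e))

    ⊗-premiseˡ : ∀ Γ → AllOccur ((A ⊗ B , p) ∷ Γ ++ Δ) → AllOccur ((A , left ∷ p) ∷ Γ)
    ⊗-premiseˡ Γ (g ∷ gs) = descend g (⊗ˡ here) ∷ ++⁻ˡ Γ gs

    ⊗-premiseʳ : ∀ Γ → AllOccur ((A ⊗ B , p) ∷ Γ ++ Δ) → AllOccur ((B , right ∷ p) ∷ Δ)
    ⊗-premiseʳ Γ (g ∷ gs) = descend g (⊗ʳ here) ∷ ++⁻ʳ Γ gs

    ⅋-premise : AllOccur ((A ⅋ B , p) ∷ Γ) → AllOccur ((A , left ∷ p) ∷ (B , right ∷ p) ∷ Γ)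
    ⅋-premise (g ∷ gs) = descend g (⅋ˡ here) ∷ descend g (⅋ʳ here) ∷ gs

    M⁺-premise : ∀ {a} → AllOccur ((M⁺ a A , p) ∷ Γ) → AllOccur ((A , under ∷ p) ∷ Γ)
    M⁺-premise (g ∷ gs) = descend g (M⁺↓ here) ∷ gs

    M⁻-premise : ∀ {a} → AllOccur ((M⁻ a A , p) ∷ Γ) → AllOccur ((A , under ∷ p) ∷ Γ)
    M⁻-premise (g ∷ gs) = descend g (M⁻↓ here) ∷ gs

    Dual : Path {Name} → Path {Name} → Set
    Dual p q = Σ[ A ∈ Formula {Name} ] Atomic A × Occurs (A ^⊥) p × Occurs A q

    dual-sym : Dual p q → Dual q p
    dual-sym (_ , (k , var)  , d , d′) = nvar k , (k , nvar) , d′ , d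
    dual-sym (_ , (k , nvar) , d , d′) = var k  , (k , var)  , d′ , d

    dual-functional : Dual p q → Dual p r → q ≡ r
    dual-functional (A , (_ , atom) , occurs d , occurs e) (B , _ , occurs d′ , occurs e′)
      with ^⊥-injective (sub-functional d d′)
    ... | refl = reverse-injective (linear atom e e′)

    axiom-dual : AllOccur Γ → (π : CutFree Γ) → (p , q) ∈ axLinks π → Dual p q
    axiom-dual g (ex σ π) m = axiom-dual (All-resp-↭ (↭-sym σ) g) π m
    axiom-dual (d ∷ d′ ∷ []) (ax A p q) (here refl) = A , dual-occurrences⇒atomic d d′ , d , d′
    axiom-dual g (⊗-r {Γ = Γ} π ρ) m with ∈-++⁻ (axLinks π) m
    ... | inj₁ m′ = axiom-dual (⊗-premiseˡ Γ g) π m′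
    ... | inj₂ m′ = axiom-dual (⊗-premiseʳ Γ g) ρ m′
    axiom-dual g (⅋-r π)  m = axiom-dual (⅋-premise g) π m
    axiom-dual g (M⁺-r π) m = axiom-dual (M⁺-premise g) π m
    axiom-dual g (M⁻-r π) m = axiom-dual (M⁻-premise g) π m

    linked-⊗ˡ : (π : CutFree ((A , left ∷ p) ∷ Γ)) (ρ : CutFree ((B , right ∷ p) ∷ Δ))
              → Linked π q r → Linked (⊗-r π ρ) q r
    linked-⊗ˡ _ _ = Sum.map ∈-++⁺ˡ ∈-++⁺ˡ

    linked-⊗ʳ : (π : CutFree ((A , left ∷ p) ∷ Γ)) (ρ : CutFree ((B , right ∷ p) ∷ Δ))
              → Linked ρ q r → Linked (⊗-r π ρ) q r
    linked-⊗ʳ π _ = Sum.map (∈-++⁺ʳ (axLinks π)) (∈-++⁺ʳ (axLinks π))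

    atom-linked : AllOccur Γ → (π : CutFree Γ) → (A , p) ∈ Γ → Sub A s B → Atomic B
                → ∃ λ r → Linked π (s ʳ++ p) r
    atom-linked g (ex σ π) m e b =
      atom-linked (All-resp-↭ (↭-sym σ) g) π (∈-resp-↭ (↭-sym σ) m) e b
    atom-linked (d ∷ d′ ∷ []) (ax A p q) (here refl) e _
      rewrite sub-atom (atom-^⊥ (proj₂ (dual-occurrences⇒atomic d d′))) e = q , inj₁ (here refl)
    atom-linked (d ∷ d′ ∷ []) (ax A p q) (there (here refl)) e _
      rewrite sub-atom (proj₂ (dual-occurrences⇒atomic d d′)) e = p , inj₂ (here refl)
    atom-linked g (⊗-r π ρ) (here refl) here (_ , ())
    atom-linked g (⊗-r {Γ = Γ} π ρ) (here refl) (⊗ˡ e) b =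
      map₂ (linked-⊗ˡ π ρ) (atom-linked (⊗-premiseˡ Γ g) π (here refl) e b)
    atom-linked g (⊗-r {Γ = Γ} π ρ) (here refl) (⊗ʳ e) b =
      map₂ (linked-⊗ʳ π ρ) (atom-linked (⊗-premiseʳ Γ g) ρ (here refl) e b)
    atom-linked g (⊗-r {Γ = Γ} π ρ) (there m) e b with ∈-++⁻ Γ m
    ... | inj₁ m′ = map₂ (linked-⊗ˡ π ρ) (atom-linked (⊗-premiseˡ Γ g) π (there m′) e b)
    ... | inj₂ m′ = map₂ (linked-⊗ʳ π ρ) (atom-linked (⊗-premiseʳ Γ g) ρ (there m′) e b)
    atom-linked g (⅋-r π) (here refl) here (_ , ())
    atom-linked g (⅋-r π) (here refl) (⅋ˡ e) b = atom-linked (⅋-premise g) π (here refl) e b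
    atom-linked g (⅋-r π) (here refl) (⅋ʳ e) b = atom-linked (⅋-premise g) π (there (here refl)) e b
    atom-linked g (⅋-r π) (there m)   e        b = atom-linked (⅋-premise g) π (there (there m)) e b
    atom-linked g (M⁺-r π) (here refl) here (_ , ())
    atom-linked g (M⁺-r π) (here refl) (M⁺↓ e) b = atom-linked (M⁺-premise g) π (here refl) e b
    atom-linked g (M⁺-r π) (there m)   e       b = atom-linked (M⁺-premise g) π (there m) e b
    atom-linked g (M⁻-r π) (here refl) here (_ , ())
    atom-linked g (M⁻-r π) (here refl) (M⁻↓ e) b = atom-linked (M⁻-premise g) π (here refl) e b
    atom-linked g (M⁻-r π) (there m)   e       b = atom-linked (M⁻-premise g) π (there m) e b

    private
      ⊢F : Set
      ⊢F = CutFree ((F , []) ∷ [])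

      all-occur-F : AllOccur ((F , []) ∷ [])
      all-occur-F = occurs here ∷ []

    linked-dual : (π : ⊢F) → Linked π p q → Dual p q
    linked-dual π (inj₁ m) = axiom-dual all-occur-F π m
    linked-dual π (inj₂ m) = dual-sym (axiom-dual all-occur-F π m)

    dual-endpoint : (π : ⊢F) → Dual p q → ∃ λ r → Linked π p r
    dual-endpoint {p} π (_ , (_ , atom) , occurs d , _) =
      subst (λ t → ∃ λ r → Linked π t r) (reverse-involutive p)
        (atom-linked all-occur-F π (here refl) d (_ , atom-^⊥ atom))

    linked-transfer : (π ρ : ⊢F) → Linked ρ p q → Linked π p q
    linked-transfer π ρ l with dual-endpoint π (linked-dual ρ l)
    ... | r , l′ = subst (Linked π _) (dual-functional (linked-dual π l′) (linked-dual ρ l)) l′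

    same-net : (π ρ : ⊢F) → SameNet π ρ
    same-net π ρ p q = mk⇔ (linked-transfer ρ π) (linked-transfer π ρ)

  record Invariant (n : ℕ) (A : Formula {Name}) (m : ℕ) : Set where
    field
      n≤m       : n ≤ m
      bounded   : ∀ {k s B} → Sub A s B → Atom k B → n ≤ k × k < m
      linear    : Linear A
      saturated : Saturated A
      compound  : ¬ Atomic A

    dualPair : DualPair A
    dualPair = saturated here compound

    fresh : Sub A s B → Atom k B → k < n → ⊥
    fresh d atom k<n = <-irrefl refl (<-≤-trans k<n (proj₁ (bounded d atom)))

  open Invariant

  invariant-one : Invariant n (nvar n ⅋ var n) (suc n)
  invariant-one {n} = record
    { n≤m = n≤1+n n
    ; bounded = bounded′ ; linear = linear′ ; saturated = saturated′ ; compound = λ () }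
    where
    bounded′ : Sub (nvar n ⅋ var n) s B → Atom k B → n ≤ k × k < suc n
    bounded′ (⅋ˡ here) nvar = ≤-refl , ≤-refl
    bounded′ (⅋ʳ here) var  = ≤-refl , ≤-refl
    linear′ : Linear (nvar n ⅋ var n)
    linear′ var  (⅋ʳ here) (⅋ʳ here) = refl
    linear′ nvar (⅋ˡ here) (⅋ˡ here) = refl
    saturated′ : Saturated (nvar n ⅋ var n)
    saturated′ here       _     = n , _ , _ , ⅋ʳ here , ⅋ˡ here
    saturated′ (⅋ˡ here) ¬atom = ⊥-elim (¬atom (n , nvar))
    saturated′ (⅋ʳ here) ¬atom = ⊥-elim (¬atom (n , var))

  invariant-⊗ : Invariant n A m → Invariant m B k → Invariant n (A ⊗ B) k
  invariant-⊗ {n} {A} {m} {B} {k} iA iB = record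
    { n≤m = ≤-trans (n≤m iA) (n≤m iB)
    ; bounded = bounded′ ; linear = linear′ ; saturated = saturated′ ; compound = λ () }
    where
    bounded′ : ∀ {j} → Sub (A ⊗ B) s C → Atom j C → n ≤ j × j < k
    bounded′ (⊗ˡ d) atom = map₂ (λ j<m → <-≤-trans j<m (n≤m iB)) (bounded iA d atom)
    bounded′ (⊗ʳ d) atom = map₁ (≤-trans (n≤m iA)) (bounded iB d atom)
    linear′ : Linear (A ⊗ B)
    linear′ atom (⊗ˡ d) (⊗ˡ e) = cong (left ∷_)  (linear iA atom d e)
    linear′ atom (⊗ʳ d) (⊗ʳ e) = cong (right ∷_) (linear iB atom d e)
    linear′ atom (⊗ˡ d) (⊗ʳ e) = ⊥-elim (fresh iB e atom (proj₂ (bounded iA d atom)))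
    linear′ atom (⊗ʳ d) (⊗ˡ e) = ⊥-elim (fresh iB d atom (proj₂ (bounded iA e atom)))
    saturated′ : Saturated (A ⊗ B)
    saturated′ here   _ = dualPair-lift (⊗ˡ here) (dualPair iA)
    saturated′ (⊗ˡ d) c = saturated iA d c
    saturated′ (⊗ʳ d) c = saturated iB d c

  invariant-pos : ∀ a → Invariant (suc n) A m → Invariant n (M⁺ a (nvar n ⅋ (A ⊗ var n))) m
  invariant-pos {n} {A} {m} a iA = record
    { n≤m = <⇒≤ (n≤m iA)
    ; bounded = bounded′ ; linear = linear′ ; saturated = saturated′ ; compound = λ () }
    where
    X : Formula {Name}
    X = M⁺ a (nvar n ⅋ (A ⊗ var n))
    bounded′ : Sub X s B → Atom k B → n ≤ k × k < m
    bounded′ (M⁺↓ (⅋ˡ here))      nvar = ≤-refl , n≤m iA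
    bounded′ (M⁺↓ (⅋ʳ (⊗ʳ here))) var  = ≤-refl , n≤m iA
    bounded′ (M⁺↓ (⅋ʳ (⊗ˡ d)))    atom = map₁ <⇒≤ (bounded iA d atom)
    linear′ : Linear X
    linear′ nvar (M⁺↓ (⅋ˡ here))      (M⁺↓ (⅋ˡ here))      = refl
    linear′ var  (M⁺↓ (⅋ʳ (⊗ʳ here))) (M⁺↓ (⅋ʳ (⊗ʳ here))) = refl
    linear′ atom (M⁺↓ (⅋ʳ (⊗ˡ d)))    (M⁺↓ (⅋ʳ (⊗ˡ e)))    =
      cong (λ t → under ∷ right ∷ left ∷ t) (linear iA atom d e)
    linear′ nvar (M⁺↓ (⅋ʳ (⊗ˡ d)))    (M⁺↓ (⅋ˡ here))      = ⊥-elim (fresh iA d nvar ≤-refl)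
    linear′ var  (M⁺↓ (⅋ʳ (⊗ˡ d)))    (M⁺↓ (⅋ʳ (⊗ʳ here))) = ⊥-elim (fresh iA d var ≤-refl)
    linear′ nvar (M⁺↓ (⅋ˡ here))      (M⁺↓ (⅋ʳ (⊗ˡ e)))    = ⊥-elim (fresh iA e nvar ≤-refl)
    linear′ var  (M⁺↓ (⅋ʳ (⊗ʳ here))) (M⁺↓ (⅋ʳ (⊗ˡ e)))    = ⊥-elim (fresh iA e var ≤-refl)
    saturated′ : Saturated X
    saturated′ here                 _     = n , _ , _ , M⁺↓ (⅋ʳ (⊗ʳ here)) , M⁺↓ (⅋ˡ here)
    saturated′ (M⁺↓ here)           _     = n , _ , _ , ⅋ʳ (⊗ʳ here) , ⅋ˡ here
    saturated′ (M⁺↓ (⅋ʳ here))      _     = dualPair-lift (⊗ˡ here) (dualPair iA)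
    saturated′ (M⁺↓ (⅋ʳ (⊗ˡ d)))    c     = saturated iA d c
    saturated′ (M⁺↓ (⅋ˡ here))      ¬atom = ⊥-elim (¬atom (n , nvar))
    saturated′ (M⁺↓ (⅋ʳ (⊗ʳ here))) ¬atom = ⊥-elim (¬atom (n , var))

  invariant-neg : ∀ a → Invariant (suc n) A m → Invariant n (M⁻ a (A ⊗ nvar n) ⅋ var n) m
  invariant-neg {n} {A} {m} a iA = record
    { n≤m = <⇒≤ (n≤m iA)
    ; bounded = bounded′ ; linear = linear′ ; saturated = saturated′ ; compound = λ () }
    where
    X : Formula {Name}
    X = M⁻ a (A ⊗ nvar n) ⅋ var n
    bounded′ : Sub X s B → Atom k B → n ≤ k × k < m
    bounded′ (⅋ˡ (M⁻↓ (⊗ʳ here))) nvar = ≤-refl , n≤m iA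
    bounded′ (⅋ʳ here)            var  = ≤-refl , n≤m iA
    bounded′ (⅋ˡ (M⁻↓ (⊗ˡ d)))    atom = map₁ <⇒≤ (bounded iA d atom)
    linear′ : Linear X
    linear′ nvar (⅋ˡ (M⁻↓ (⊗ʳ here))) (⅋ˡ (M⁻↓ (⊗ʳ here))) = refl
    linear′ var  (⅋ʳ here)            (⅋ʳ here)            = refl
    linear′ atom (⅋ˡ (M⁻↓ (⊗ˡ d)))    (⅋ˡ (M⁻↓ (⊗ˡ e)))    =
      cong (λ t → left ∷ under ∷ left ∷ t) (linear iA atom d e)
    linear′ nvar (⅋ˡ (M⁻↓ (⊗ˡ d)))    (⅋ˡ (M⁻↓ (⊗ʳ here))) = ⊥-elim (fresh iA d nvar ≤-refl)
    linear′ var  (⅋ˡ (M⁻↓ (⊗ˡ d)))    (⅋ʳ here)            = ⊥-elim (fresh iA d var ≤-refl)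
    linear′ nvar (⅋ˡ (M⁻↓ (⊗ʳ here))) (⅋ˡ (M⁻↓ (⊗ˡ e)))    = ⊥-elim (fresh iA e nvar ≤-refl)
    linear′ var  (⅋ʳ here)            (⅋ˡ (M⁻↓ (⊗ˡ e)))    = ⊥-elim (fresh iA e var ≤-refl)
    saturated′ : Saturated X
    saturated′ here                 _     = n , _ , _ , ⅋ʳ here , ⅋ˡ (M⁻↓ (⊗ʳ here))
    saturated′ (⅋ˡ here)            _     = dualPair-lift (M⁻↓ (⊗ˡ here)) (dualPair iA)
    saturated′ (⅋ˡ (M⁻↓ here))      _     = dualPair-lift (⊗ˡ here) (dualPair iA)
    saturated′ (⅋ˡ (M⁻↓ (⊗ˡ d)))    c     = saturated iA d c
    saturated′ (⅋ˡ (M⁻↓ (⊗ʳ here))) ¬atom = ⊥-elim (¬atom (n , nvar))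
    saturated′ (⅋ʳ here)            ¬atom = ⊥-elim (¬atom (n , var))

  invariant : ∀ (P : Term {Name}) n → Invariant n (proj₁ (translate P n)) (proj₂ (translate P n))
  invariant one n = invariant-one
  invariant (P ∥ Q) n with translate P n | invariant P n
  ... | A , m | iA with translate Q m | invariant Q m
  ...   | B , k | iB = invariant-⊗ iA iB
  invariant (pos a P) n with translate P (suc n) | invariant P (suc n)
  ... | A , m | iA = invariant-pos a iA
  invariant (neg a P) n with translate P (suc n) | invariant P (suc n)
  ... | A , m | iA = invariant-neg a iA

  translation-proof : ∀ (P : Term {Name}) n p → CutFree ((proj₁ (translate P n) , p) ∷ [])
  translation-proof one n p = ⅋-r (ax (var n) (left ∷ p) (right ∷ p))
  translation-proof (P ∥ Q) n p with translate P n | translation-proof P n (left ∷ p)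
  ... | A , m | πA with translate Q m | translation-proof Q m (right ∷ p)
  ...   | B , k | πB = ⊗-r πA πB
  translation-proof (pos a P) n p
    with translate P (suc n) | translation-proof P (suc n) (left ∷ right ∷ under ∷ p)
  ... | A , m | πA =
    M⁺-r (⅋-r (ex (swap _ _ ↭-refl) (⊗-r πA (ax (nvar n) (right ∷ right ∷ under ∷ p) (left ∷ under ∷ p)))))
  translation-proof (neg a P) n p
    with translate P (suc n) | translation-proof P (suc n) (left ∷ under ∷ left ∷ p)
  ... | A , m | πA = ⅋-r (M⁻-r (⊗-r πA (ax (var n) (right ∷ under ∷ left ∷ p) (right ∷ p))))

proposition7 : {Name : Set} (P : Term {Name}) →
    Σ (CutFree ((⌈ P ⌉ , []) ∷ [])) (λ π → (ρ : CutFree ((⌈ P ⌉ , []) ∷ [])) → SameNet ρ π)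
proposition7 P = proof , λ ρ → same-net (Invariant.linear inv) (Invariant.saturated inv) ρ proof
  where
  proof : CutFree ((⌈ P ⌉ , []) ∷ [])
  proof = translation-proof P 0 []
  inv : Invariant 0 ⌈ P ⌉ (proj₂ (translate P 0))
  inv = invariant P 0
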